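{- Let $X,Y$ be strings, $a\in\mathbb{Z}_{+}$, $k\in\mathbb{R}_{+}$, and let $V=\{0,\frac1a,\frac2a,\ldots,\frac1a\lfloor ak\rfloor\}$. Define values $\mathbf{D}_v[s]$ as follows. All values $\mathbf{D}_v[s]$ not explicitly assigned below (in particular for $v\notin V$, e.g. $v<0$, and for $s\notin[-\lfloor v\rfloor..\lfloor v\rfloor]$) equal $-\infty$. Processing $v\in V$ in increasing order, and for each such $v$ every $s\in[-\lfloor v\rfloor..\lfloor v\rfloor]$: $\mathbf{D}'_v[s]=\min\big(|X|,\,|Y|-s,\,\max(\mathbf{D}_{v-1}[s-1],\,\mathbf{D}_{v-\frac1a}[s]+1,\,\mathbf{D}_{v-1}[s+1]+1)\big)$; if $s=0$, then $\mathbf{D}'_v[s]$ is replaced by $\max(\mathbf{D}'_v[s],0)$; finally $\mathbf{D}_v[s]=\mathbf{D}'_v[s]+\mathsf{LCE}(\mathbf{D}'_v[s],\mathbf{D}'_v[s]+s)$. Then for every $v\in V$, $x\in[0..|X|]$ and $y\in[0..|Y|]$, we have $T[x,y]\le v$ if and only if $\mathbf{D}_v[y-x]\ge x$.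
   Context: For $a\ge 1$, $\mathtt{ED}_a(X,Y)$ denotes the minimum total cost of a sequence of edit operations transforming $X$ into $Y$, where insertions and deletions cost $1$ and substitutions cost $\frac1a$. Strings are 0-indexed, $X[i..j)=X[i]\cdots X[j-1]$, and $T[x,y]=\mathtt{ED}_a(X[0..x),Y[0..y))$. $\mathsf{LCE}(x,y)=\max\{\ell\in[0..\min(|X|-x,|Y|-y)]: X[x..x+\ell)=Y[y..y+\ell)\}$. Arithmetic conventions: $-\infty+1=-\infty$, and if $\mathbf{D}'_v[s]=-\infty$ then $\mathbf{D}_v[s]=-\infty$. -}

module Defs where

open import Data.Nat as ℕ using (ℕ; zero; suc; NonZero; _/_)
open import Data.Integer as ℤ using (ℤ; +_; -[1+_]; _⊓_; _⊔_; ∣_∣)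
open import Data.List using (List; []; _∷_; _++_; drop; length)
open import Data.Product using (∃; _×_)
open import Relation.Nullary using (yes; no)
open import Relation.Binary.Definitions using (DecidableEquality)

-- All costs are scaled by a: insertion/deletion cost a (i.e. 1),
-- substitution cost 1 (i.e. 1/a).  So "ED_a(X,Y) ≤ j/a" is
-- "some sequence of edit operations has scaled cost ≤ j".

module _ {A : Set} (a : ℕ) where

  data Step : List A → List A → ℕ → Set where
    ins : (u w : List A) (c : A)   → Step (u ++ w) (u ++ c ∷ w) a
    del : (u w : List A) (c : A)   → Step (u ++ c ∷ w) (u ++ w) a
    sub : (u w : List A) (c d : A) → Step (u ++ c ∷ w) (u ++ d ∷ w) 1

  data Edits : List A → List A → ℕ → Set where
    done : ∀ {X} → Edits X X 0
    step : ∀ {X Z Y c d} → Step X Z c → Edits Z Y d → Edits X Y (c ℕ.+ d)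

  EDa≤ : List A → List A → ℕ → Set
  EDa≤ X Y j = ∃ λ c → Edits X Y c × c ℕ.≤ j

data ℤ∞ : Set where
  -∞  : ℤ∞
  fin : ℤ → ℤ∞

max∞ : ℤ∞ → ℤ∞ → ℤ∞
max∞ -∞ b = b
max∞ (fin x) -∞ = fin x
max∞ (fin x) (fin y) = fin (x ⊔ y)

min∞ : ℤ → ℤ∞ → ℤ∞
min∞ z -∞ = -∞
min∞ z (fin w) = fin (z ⊓ w)

inc∞ : ℤ∞ → ℤ∞
inc∞ -∞ = -∞
inc∞ (fin x) = fin (x ℤ.+ + 1)

infix 4 _≤∞_
data _≤∞_ : ℤ → ℤ∞ → Set where
  fin≤ : ∀ {x y} → x ℤ.≤ y → x ≤∞ fin y

module _ {A : Set} (_≟_ : DecidableEquality A) where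

  lcp : List A → List A → ℕ
  lcp (c ∷ u) (d ∷ w) with c ≟ d
  ... | yes _ = suc (lcp u w)
  ... | no  _ = 0
  lcp _ _ = 0

  -- LCE(x,y) = max ℓ with X[x..x+ℓ) = Y[y..y+ℓ);
  -- for a negative position only ℓ = 0 is meaningful, so LCE = 0.
  LCE : List A → List A → ℤ → ℤ → ℕ
  LCE X Y (+ x) (+ y) = lcp (drop x X) (drop y Y)
  LCE X Y _ _ = 0

-- The table D_v[s], with v = j/a indexed by j ∈ ℕ.

prevRow : ℕ → (ℕ → ℤ → ℤ∞) → ℤ → ℤ∞
prevRow zero P t = -∞
prevRow (suc j') P t = P j' t

module Table {A : Set} (_≟_ : DecidableEquality A) (X Y : List A)
             (a : ℕ) .{{_ : NonZero a}} where

  -- one entry D_{j}[s], given the previously computed entries P i s (i < j)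
  entry : ℕ → (ℕ → ℤ → ℤ∞) → ℤ → ℤ∞
  entry j P s with ∣ s ∣ ℕ.≤? j / a
  ... | no _ = -∞
  ... | yes _ = finish D''
    where
      Dm1 : ℤ → ℤ∞
      Dm1 t with a ℕ.≤? j
      ... | yes _ = P (j ℕ.∸ a) t
      ... | no  _ = -∞
      Dma : ℤ → ℤ∞
      Dma t = prevRow j P t
      D' : ℤ∞
      D' = min∞ (+ length X) (min∞ (+ length Y ℤ.- s)
             (max∞ (Dm1 (s ℤ.- + 1))
               (max∞ (inc∞ (Dma s)) (inc∞ (Dm1 (s ℤ.+ + 1))))))
      D'' : ℤ∞
      D'' with s ℤ.≟ + 0
      ... | yes _ = max∞ D' (fin (+ 0))
      ... | no  _ = D'
      finish : ℤ∞ → ℤ∞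
      finish -∞ = -∞
      finish (fin d) = fin (d ℤ.+ + LCE _≟_ X Y d (d ℤ.+ s))

  -- tab n i s = D_{i/a}[s] for i < n, and -∞ otherwise
  tab : ℕ → ℕ → ℤ → ℤ∞
  tab zero i s = -∞
  tab (suc n) i s with i ℕ.<? n | i ℕ.≟ n
  ... | yes _ | _     = tab n i s
  ... | no _  | yes _ = entry n (tab n) s
  ... | no _  | no _  = -∞

  D : ℕ → ℤ → ℤ∞
  D j s = tab (suc j) j s

-- An edit sequence of cost c can be normalised into an alignment, i.e. a monotone path
-- from (0,0) to (x,y) in the grid of prefix pairs, made of deletions and insertions
-- (cost a, i.e. 1), substitutions (cost 1, i.e. 1/a) and free matches; so T[x,y] ≤ j/a
-- iff such a path of cost at most j exists.  Such paths can always be shortened along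
-- a diagonal, since T[x,y] ≤ T[x+1,y+1].  If a path reaches (x,y), its last non-match
-- step is one of the three terms of the maximum defining D′_v[s], and matches only
-- continue the LCE run, so D_v[y-x] ≥ x.  Conversely, by induction on v, the point
-- D′_v[s] is reached by the step that attains the maximum (or is the origin), the LCE
-- run from there is a run of matches, and every point below its end on the diagonal
-- is reached by shortening.

module Submission where

open import Defs
open import Data.Nat using (ℕ; NonZero; _≤_)
open import Data.Integer using (+_; _-_)
open import Data.List using (List; length; take)
open import Function.Bundles using (_⇔_)
open import Relation.Binary.Definitions using (DecidableEquality)

open import Data.Nat as ℕ using (zero; suc; _+_; _∸_; _*_; _<_; z≤n; s≤s; _/_)
open import Data.Nat.Properties
open import Data.Nat.DivMod using (m*n/n≡m; m/n*n≤m; /-monoˡ-≤)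
open import Data.Integer as ℤ using (ℤ; -[1+_]; ∣_∣)
import Data.Integer.Properties as ℤ
open import Data.List using ([]; _∷_; _++_; [_]; drop; head)
open import Data.List.Properties using (++-assoc; ++-identityʳ; length-take; take++drop≡id; drop-[])
open import Data.Maybe using (just)
open import Data.Product using (∃; _×_; _,_; proj₁; proj₂)
open import Data.Sum using (_⊎_; inj₁; inj₂)
open import Data.Empty using (⊥; ⊥-elim)
open import Function.Bundles using (mk⇔)
open import Data.Integer.Tactic.RingSolver using (solve-∀)
open import Algebra.Properties.CommutativeSemigroup +-commutativeSemigroup using (x∙yz≈y∙xz; xy∙z≈y∙xz; xy∙z≈zy∙x; xy∙z≈xz∙y)
open import Relation.Nullary using (Dec; yes; no; ¬_)
open import Relation.Binary.PropositionalEquality hiding ([_])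
open import Induction.WellFounded using (WfRec)
open import Data.Nat.Induction using (<-rec)

-- Arithmetic on ℕ and lists

1+m∸n≤1+[m∸n] : ∀ m n → suc m ∸ n ≤ suc (m ∸ n)
1+m∸n≤1+[m∸n] m n =
  m≤n+o⇒m∸n≤o (suc m) n (subst (suc m ≤_) (sym (+-suc n (m ∸ n))) (s≤s (m≤n+m∸n m n)))

m≤o∸n⇒n+m≤o : ∀ {m n o} → n ≤ o → m ≤ o ∸ n → n + m ≤ o
m≤o∸n⇒n+m≤o {m} {n} {o} n≤o m≤o∸n = subst (_≤ o) (+-comm m n) (m≤o∸n⇒m+n≤o m n≤o m≤o∸n)

n+m≤o⇒m≤o∸n : ∀ {m n o} → n + m ≤ o → m ≤ o ∸ n
n+m≤o⇒m≤o∸n {m} {n} {o} n+m≤o = subst (_≤ o ∸ n) (m+n∸m≡n n m) (∸-monoˡ-≤ n n+m≤o)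

m*n≤o⇒m≤o/n : ∀ {m n o} .{{_ : NonZero n}} → m * n ≤ o → m ≤ o / n
m*n≤o⇒m≤o/n {m} {n} {o} m*n≤o = subst (_≤ o / n) (m*n/n≡m m n) (/-monoˡ-≤ n m*n≤o)

m≤o/n⇒m*n≤o : ∀ {m n o} .{{_ : NonZero n}} → m ≤ o / n → m * n ≤ o
m≤o/n⇒m*n≤o {m} {n} {o} m≤o/n = ≤-trans (*-monoˡ-≤ n m≤o/n) (m/n*n≤m o n)

module _ {A : Set} where

  drop-suc : ∀ (V : List A) i {c t} → c ∷ t ≡ drop i V → t ≡ drop (suc i) V
  drop-suc (d ∷ V) zero    refl = refl
  drop-suc (d ∷ V) (suc i) eq   = drop-suc V i eq

  drop-+ : ∀ (V : List A) m n → drop (m + n) V ≡ drop n (drop m V)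
  drop-+ V       zero    n = refl
  drop-+ []      (suc m) n = sym (drop-[] n)
  drop-+ (c ∷ V) (suc m) n = drop-+ V m n

  head-drop : ∀ (V : List A) i → i < length V → ∃ λ c → head (drop i V) ≡ just c
  head-drop (c ∷ V) zero    _          = c , refl
  head-drop (c ∷ V) (suc i) (s≤s i<∣V∣) = head-drop V i i<∣V∣

  take-suc-head : ∀ (V : List A) i {c} → head (drop i V) ≡ just c → take (suc i) V ≡ take i V ++ [ c ]
  take-suc-head (d ∷ V) zero    refl = refl
  take-suc-head (d ∷ V) (suc i) eq   = cong (d ∷_) (take-suc-head V i eq)

  length-take-≤ : ∀ (V : List A) i → i ≤ length V → length (take i V) ≡ i
  length-take-≤ V i i≤∣V∣ = trans (length-take i V) (m≤n⇒m⊓n≡m i≤∣V∣)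

module _ {A : Set} (_≟_ : DecidableEquality A) where

  lcp-head : ∀ (u w : List A) ℓ → ℓ < lcp _≟_ u w →
             ∃ λ c → head (drop ℓ u) ≡ just c × head (drop ℓ w) ≡ just c
  lcp-head (c ∷ u) (d ∷ w) ℓ ℓ<lcp with c ≟ d
  lcp-head (c ∷ u) (.c ∷ w) zero    _             | yes refl = c , refl , refl
  lcp-head (c ∷ u) (.c ∷ w) (suc ℓ) (s≤s ℓ<lcp)   | yes refl = lcp-head u w ℓ ℓ<lcp

  lcp-maximal : ∀ (u w : List A) {c} → let ℓ = lcp _≟_ u w in
                head (drop ℓ u) ≡ just c → head (drop ℓ w) ≡ just c → ⊥
  lcp-maximal (c ∷ u) (d ∷ w) u≡c w≡c with c ≟ d
  ... | yes refl = lcp-maximal u w u≡c w≡c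
  lcp-maximal (c ∷ u) (d ∷ w) refl refl | no c≢d = c≢d refl

-- The order on ℤ ∪ {-∞}

≤∞-trans : ∀ {v w p} → v ℤ.≤ w → w ≤∞ p → v ≤∞ p
≤∞-trans v≤w (fin≤ w≤p) = fin≤ (ℤ.≤-trans v≤w w≤p)

≤∞-max∞ˡ : ∀ {v} p q → v ≤∞ p → v ≤∞ max∞ p q
≤∞-max∞ˡ (fin p) -∞      v≤p        = v≤p
≤∞-max∞ˡ (fin p) (fin q) (fin≤ v≤p) = fin≤ (ℤ.≤-trans v≤p (ℤ.i≤i⊔j p q))

≤∞-max∞ʳ : ∀ {v} p q → v ≤∞ q → v ≤∞ max∞ p q
≤∞-max∞ʳ -∞      q       v≤q        = v≤q
≤∞-max∞ʳ (fin p) (fin q) (fin≤ v≤q) = fin≤ (ℤ.≤-trans v≤q (ℤ.i≤j⊔i p q))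

≤∞-max∞⁻ : ∀ {v} p q → v ≤∞ max∞ p q → v ≤∞ p ⊎ v ≤∞ q
≤∞-max∞⁻ -∞      q       v≤q = inj₂ v≤q
≤∞-max∞⁻ (fin p) -∞      v≤p = inj₁ v≤p
≤∞-max∞⁻ (fin p) (fin q) (fin≤ v≤p⊔q) with ℤ.⊔-sel p q
... | inj₁ p⊔q≡p = inj₁ (fin≤ (subst (_ ℤ.≤_) p⊔q≡p v≤p⊔q))
... | inj₂ p⊔q≡q = inj₂ (fin≤ (subst (_ ℤ.≤_) p⊔q≡q v≤p⊔q))

≤∞-min∞ : ∀ {v} z p → v ℤ.≤ z → v ≤∞ p → v ≤∞ min∞ z p
≤∞-min∞ z (fin p) v≤z (fin≤ v≤p) = fin≤ (ℤ.⊓-glb v≤z v≤p)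

≤∞-min∞⁻ : ∀ {v} z p → v ≤∞ min∞ z p → v ℤ.≤ z × v ≤∞ p
≤∞-min∞⁻ z (fin p) (fin≤ v≤z⊓p) =
  ℤ.≤-trans v≤z⊓p (ℤ.i⊓j≤i z p) , fin≤ (ℤ.≤-trans v≤z⊓p (ℤ.i⊓j≤j z p))

≤∞-inc∞ : ∀ {v} p → v ≤∞ p → ℤ.suc v ≤∞ inc∞ p
≤∞-inc∞ {v} (fin p) (fin≤ v≤p) = fin≤ (subst (ℤ.suc v ℤ.≤_) (ℤ.+-comm (+ 1) p) (ℤ.suc-mono v≤p))

≤∞-inc∞⁻ : ∀ {v} p → ℤ.suc v ≤∞ inc∞ p → v ≤∞ p
≤∞-inc∞⁻ {v} (fin p) (fin≤ 1+v≤p+1) =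
  fin≤ (subst₂ ℤ._≤_ (ℤ.pred-suc v) (trans (cong ℤ.pred (ℤ.+-comm p (+ 1))) (ℤ.pred-suc p))
                   (ℤ.pred-mono 1+v≤p+1))

-- Diagonals of the grid

diagonal : ℕ → ℕ → ℤ
diagonal x y = + y - + x

diagonal-suc : ∀ x y → diagonal (suc x) (suc y) ≡ diagonal x y
diagonal-suc x y = lemma (+ x) (+ y)
  where lemma : ∀ (i k : ℤ) → (+ 1 ℤ.+ k) - (+ 1 ℤ.+ i) ≡ k - i
        lemma = solve-∀

diagonal-sucˣ : ∀ x y → diagonal (suc x) y ℤ.+ + 1 ≡ diagonal x y
diagonal-sucˣ x y = lemma (+ x) (+ y)
  where lemma : ∀ (i k : ℤ) → (k - (+ 1 ℤ.+ i)) ℤ.+ + 1 ≡ k - i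
        lemma = solve-∀

diagonal-sucʸ : ∀ x y → diagonal x (suc y) - + 1 ≡ diagonal x y
diagonal-sucʸ x y = lemma (+ x) (+ y)
  where lemma : ∀ (i k : ℤ) → ((+ 1 ℤ.+ k) - i) - + 1 ≡ k - i
        lemma = solve-∀

∣diagonal∣≤ : ∀ x y {m} → x ∸ y ≤ m → y ∸ x ≤ m → ∣ diagonal x y ∣ ≤ m
∣diagonal∣≤ x y x∸y≤m y∸x≤m rewrite ℤ.m-n≡m⊖n y x with x ℕ.≤? y
... | yes x≤y rewrite ℤ.⊖-≥ x≤y = y∸x≤m
... | no  x≰y rewrite ℤ.⊖-< (≰⇒> x≰y) | ℤ.∣-i∣≡∣i∣ (+ (x ∸ y)) = x∸y≤m

∣diagonal-0y∣ : ∀ y → ∣ diagonal 0 y ∣ ≡ y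
∣diagonal-0y∣ y = +-identityʳ y

∣diagonal-x0∣ : ∀ x → ∣ diagonal x 0 ∣ ≡ x
∣diagonal-x0∣ zero    = refl
∣diagonal-x0∣ (suc x) = refl

x≤L-diagonal : ∀ L x y → y ≤ L → + x ℤ.≤ + L - diagonal x y
x≤L-diagonal L x y y≤L = subst (+ x ℤ.≤_) (sym L-diagonal) (ℤ.+≤+ (m≤n+m x (L ∸ y)))
  where
    lemma : ∀ (l i k : ℤ) → l - (k - i) ≡ (l - k) ℤ.+ i
    lemma = solve-∀
    L-diagonal : + L - diagonal x y ≡ + (L ∸ y + x)
    L-diagonal = trans (lemma (+ L) (+ x) (+ y)) (cong (ℤ._+ + x) (trans (ℤ.m-n≡m⊖n L y) (ℤ.⊖-≥ y≤L)))

p+diagonal≡q : ∀ p q x y → + p ℤ.+ diagonal x y ≡ + q → q + x ≡ p + y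
p+diagonal≡q p q x y eq = ℤ.+-injective (trans (cong (ℤ._+ + x) (sym eq)) (lemma (+ p) (+ x) (+ y)))
  where lemma : ∀ (P i k : ℤ) → (P ℤ.+ (k - i)) ℤ.+ i ≡ P ℤ.+ k
        lemma = solve-∀

p+diagonal≢-[1+m] : ∀ p x y {m} → x ≤ p → + p ℤ.+ diagonal x y ≢ -[1+ m ]
p+diagonal≢-[1+m] p x y x≤p eq = +≢-[1+] (trans (sym p+diagonal≡) eq)
  where
    +≢-[1+] : ∀ {n m} → + n ≢ -[1+ m ]
    +≢-[1+] ()
    p+diagonal≡ : + p ℤ.+ diagonal x y ≡ + (p + y ∸ x)
    p+diagonal≡ = trans (sym (ℤ.+-assoc (+ p) (+ y) (ℤ.- + x)))
                        (trans (ℤ.m-n≡m⊖n (p + y) x) (ℤ.⊖-≥ (≤-trans x≤p (m≤m+n p y))))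

diagonal≡ : ∀ p q (s : ℤ) → + p ℤ.+ s ≡ + q → diagonal p q ≡ s
diagonal≡ p q s eq = trans (cong (_- + p) (sym eq)) (lemma (+ p) s)
  where lemma : ∀ (P S : ℤ) → (P ℤ.+ S) - P ≡ S
        lemma = solve-∀

q≤L : ∀ p q L (s : ℤ) → + p ℤ.+ s ≡ + q → + p ℤ.≤ + L - s → q ≤ L
q≤L p q L s eq p≤L-s = ℤ.drop‿+≤+ (subst₂ ℤ._≤_ eq (lemma (+ L) s) (ℤ.+-monoˡ-≤ s p≤L-s))
  where lemma : ∀ (l S : ℤ) → (l - S) ℤ.+ S ≡ l
        lemma = solve-∀

-- Edit sequences and alignments

module _ {A : Set} {a : ℕ} where

  step-++ʳ : ∀ {U Z : List A} {k} V → Step a U Z k → Step a (U ++ V) (Z ++ V) k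
  step-++ʳ V (ins u w c) =
    subst₂ (λ U Z → Step a U Z a) (sym (++-assoc u w V)) (sym (++-assoc u (c ∷ w) V)) (ins u (w ++ V) c)
  step-++ʳ V (del u w c) =
    subst₂ (λ U Z → Step a U Z a) (sym (++-assoc u (c ∷ w) V)) (sym (++-assoc u w V)) (del u (w ++ V) c)
  step-++ʳ V (sub u w c d) =
    subst₂ (λ U Z → Step a U Z 1) (sym (++-assoc u (c ∷ w) V)) (sym (++-assoc u (d ∷ w) V))
           (sub u (w ++ V) c d)

  edits-++ʳ : ∀ {U Z : List A} {k} V → Edits a U Z k → Edits a (U ++ V) (Z ++ V) k
  edits-++ʳ V done       = done
  edits-++ʳ V (step s e) = step (step-++ʳ V s) (edits-++ʳ V e)

  delete-last : ∀ (U : List A) c → Step a (U ++ [ c ]) U a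
  delete-last U c = subst (λ Z → Step a (U ++ [ c ]) Z a) (++-identityʳ U) (del U [] c)

  insert-last : ∀ (U : List A) c → Step a U (U ++ [ c ]) a
  insert-last U c = subst (λ Z → Step a Z (U ++ [ c ]) a) (++-identityʳ U) (ins U [] c)

module Alignments {A : Set} (a : ℕ) where

  infixr 5 del∷_ ins∷_ mat∷_ sub∷_

  data Alignment : List A → List A → ℕ → Set where
    ∅     : Alignment [] [] 0
    del∷_ : ∀ {c u w k} → Alignment u w k → Alignment (c ∷ u) w (a + k)
    ins∷_ : ∀ {c u w k} → Alignment u w k → Alignment u (c ∷ w) (a + k)
    mat∷_ : ∀ {c u w k} → Alignment u w k → Alignment (c ∷ u) (c ∷ w) k
    sub∷_ : ∀ {c d u w k} → Alignment u w k → Alignment (c ∷ u) (d ∷ w) (suc k)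

  Alignment≤ : List A → List A → ℕ → Set
  Alignment≤ U W j = ∃ λ k → k ≤ j × Alignment U W k

  exactly : ∀ {U W k} → Alignment U W k → Alignment≤ U W k
  exactly p = _ , ≤-refl , p

  weaken : ∀ {U W j j'} → j ≤ j' → Alignment≤ U W j → Alignment≤ U W j'
  weaken j≤j' (k , k≤j , p) = k , ≤-trans k≤j j≤j' , p

  del∷≤ : ∀ {c u w j} → Alignment≤ u w j → Alignment≤ (c ∷ u) w (a + j)
  del∷≤ (k , k≤j , p) = a + k , +-monoʳ-≤ a k≤j , del∷ p

  ins∷≤ : ∀ {c u w j} → Alignment≤ u w j → Alignment≤ u (c ∷ w) (a + j)
  ins∷≤ (k , k≤j , p) = a + k , +-monoʳ-≤ a k≤j , ins∷ p

  mat∷≤ : ∀ {c u w j} → Alignment≤ u w j → Alignment≤ (c ∷ u) (c ∷ w) j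
  mat∷≤ (k , k≤j , p) = k , k≤j , mat∷ p

  sub∷≤ : ∀ {c d u w j} → Alignment≤ u w j → Alignment≤ (c ∷ u) (d ∷ w) (suc j)
  sub∷≤ (k , k≤j , p) = suc k , s≤s k≤j , sub∷ p

  alignment-refl : ∀ U → Alignment U U 0
  alignment-refl []      = ∅
  alignment-refl (c ∷ U) = mat∷ alignment-refl U

  remove-char : ∀ u {w W c d} → Alignment (u ++ c ∷ w) W d → Alignment≤ (u ++ w) W (a + d)
  remove-char []      (del∷_ {k = k} p) = k , ≤-trans (m≤n+m k a) (m≤n+m (a + k) a) , p
  remove-char []      (ins∷ p)          = ins∷≤ (remove-char [] p)
  remove-char []      (mat∷ p)          = exactly (ins∷ p)
  remove-char []      (sub∷_ {k = k} p) = weaken (+-monoʳ-≤ a (n≤1+n k)) (exactly (ins∷ p))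
  remove-char (e ∷ u) (del∷ p)          = del∷≤ (remove-char u p)
  remove-char (e ∷ u) (ins∷ p)          = ins∷≤ (remove-char (e ∷ u) p)
  remove-char (e ∷ u) (mat∷ p)          = mat∷≤ (remove-char u p)
  remove-char (e ∷ u) (sub∷_ {k = k} p) =
    weaken (≤-reflexive (sym (+-suc a k))) (sub∷≤ (remove-char u p))

  insert-char : ∀ u {w W c d} → Alignment (u ++ w) W d → Alignment≤ (u ++ c ∷ w) W (a + d)
  insert-char []      p                 = exactly (del∷ p)
  insert-char (e ∷ u) (del∷ p)          = del∷≤ (insert-char u p)
  insert-char (e ∷ u) (ins∷ p)          = ins∷≤ (insert-char (e ∷ u) p)
  insert-char (e ∷ u) (mat∷ p)          = mat∷≤ (insert-char u p)
  insert-char (e ∷ u) (sub∷_ {k = k} p) =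
    weaken (≤-reflexive (sym (+-suc a k))) (sub∷≤ (insert-char u p))

  replace-char : ∀ u {w W c c' d} → Alignment (u ++ c' ∷ w) W d → Alignment≤ (u ++ c ∷ w) W (suc d)
  replace-char []      (del∷ p)          = weaken (n≤1+n _) (exactly (del∷ p))
  replace-char []      (ins∷_ {k = k} p) =
    weaken (≤-reflexive (+-suc a k)) (ins∷≤ (replace-char [] p))
  replace-char []      (mat∷ p)          = exactly (sub∷ p)
  replace-char []      (sub∷ p)          = weaken (n≤1+n _) (exactly (sub∷ p))
  replace-char (e ∷ u) (del∷_ {k = k} p) =
    weaken (≤-reflexive (+-suc a k)) (del∷≤ (replace-char u p))
  replace-char (e ∷ u) (ins∷_ {k = k} p) =
    weaken (≤-reflexive (+-suc a k)) (ins∷≤ (replace-char (e ∷ u) p))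
  replace-char (e ∷ u) (mat∷ p)          = mat∷≤ (replace-char u p)
  replace-char (e ∷ u) (sub∷ p)          = sub∷≤ (replace-char u p)

  step-alignment : ∀ {U Z W c d} → Step a U Z c → Alignment Z W d → Alignment≤ U W (c + d)
  step-alignment (ins u w c)   p = remove-char u p
  step-alignment (del u w c)   p = insert-char u p
  step-alignment (sub u w c d) p = replace-char u p

  edits⇒alignment : ∀ {U W c} → Edits a U W c → Alignment≤ U W c
  edits⇒alignment {U} done = exactly (alignment-refl U)
  edits⇒alignment (step {c = c} s e) with edits⇒alignment e
  ... | k , k≤d , p = weaken (+-monoʳ-≤ c k≤d) (step-alignment s p)

-- Paths through the grid of prefix pairs

module Paths {A : Set} (X Y : List A) (a : ℕ) where
  open Alignments {A} a

  Match : ℕ → ℕ → Set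
  Match x y = ∃ λ c → head (drop x X) ≡ just c × head (drop y Y) ≡ just c

  -- Path j x y : T[x,y] ≤ j/a, witnessed by a path whose steps follow the recurrence.
  data Path : ℕ → ℕ → ℕ → Set where
    origin     : ∀ {j} → Path j 0 0
    delete     : ∀ {j x y} → a ≤ j → Path (j ∸ a) x y → Path j (suc x) y
    insert     : ∀ {j x y} → a ≤ j → Path (j ∸ a) x y → Path j x (suc y)
    substitute : ∀ {j x y} → Path j x y → Path (suc j) (suc x) (suc y)
    match      : ∀ {j x y} → Match x y → Path j x y → Path j (suc x) (suc y)

  cast : ∀ {j j' x x' y y'} → j ≡ j' → x ≡ x' → y ≡ y' → Path j x y → Path j' x' y'
  cast refl refl refl p = p

  delete′ : ∀ {k x y} → Path k x y → Path (a + k) (suc x) y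
  delete′ {k} p = delete (m≤m+n a k) (cast (sym (m+n∸m≡n a k)) refl refl p)

  insert′ : ∀ {k x y} → Path k x y → Path (a + k) x (suc y)
  insert′ {k} p = insert (m≤m+n a k) (cast (sym (m+n∸m≡n a k)) refl refl p)

  Path-mono : ∀ {j j' x y} → j ≤ j' → Path j x y → Path j' x y
  Path-mono j≤j'       origin         = origin
  Path-mono j≤j'       (delete a≤j p) = delete (≤-trans a≤j j≤j') (Path-mono (∸-monoˡ-≤ a j≤j') p)
  Path-mono j≤j'       (insert a≤j p) = insert (≤-trans a≤j j≤j') (Path-mono (∸-monoˡ-≤ a j≤j') p)
  Path-mono (s≤s j≤j') (substitute p) = substitute (Path-mono j≤j' p)
  Path-mono j≤j'       (match m p)    = match m (Path-mono j≤j' p)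

  path⇒EDa≤ : ∀ {j x y} → Path j x y → x ≤ length X → y ≤ length Y →
              EDa≤ a (take x X) (take y Y) j
  path⇒EDa≤ origin _ _ = 0 , done , z≤n
  path⇒EDa≤ {x = suc x} (delete a≤j p) x<∣X∣ y≤∣Y∣
    with head-drop X x x<∣X∣ | path⇒EDa≤ p (<⇒≤ x<∣X∣) y≤∣Y∣
  ... | c , Xx≡c | k , e , k≤ =
    a + k , subst (λ U → Edits a U _ _) (sym (take-suc-head X x Xx≡c)) (step (delete-last _ c) e) ,
    m≤o∸n⇒n+m≤o a≤j k≤
  path⇒EDa≤ {y = suc y} (insert a≤j p) x≤∣X∣ y<∣Y∣
    with head-drop Y y y<∣Y∣ | path⇒EDa≤ p x≤∣X∣ (<⇒≤ y<∣Y∣)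
  ... | c , Yy≡c | k , e , k≤ =
    a + k , subst (λ W → Edits a _ W _) (sym (take-suc-head Y y Yy≡c))
                  (step (insert-last _ c) (edits-++ʳ [ c ] e)) ,
    m≤o∸n⇒n+m≤o a≤j k≤
  path⇒EDa≤ {x = suc x} {suc y} (substitute p) x<∣X∣ y<∣Y∣
    with head-drop X x x<∣X∣ | head-drop Y y y<∣Y∣ | path⇒EDa≤ p (<⇒≤ x<∣X∣) (<⇒≤ y<∣Y∣)
  ... | c , Xx≡c | d , Yy≡d | k , e , k≤ =
    suc k , subst₂ (λ U W → Edits a U W _) (sym (take-suc-head X x Xx≡c)) (sym (take-suc-head Y y Yy≡d))
                   (step (sub (take x X) [] c d) (edits-++ʳ [ d ] e)) ,
    s≤s k≤
  path⇒EDa≤ {x = suc x} {suc y} (match (c , Xx≡c , Yy≡c) p) x<∣X∣ y<∣Y∣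
    with path⇒EDa≤ p (<⇒≤ x<∣X∣) (<⇒≤ y<∣Y∣)
  ... | k , e , k≤ =
    k , subst₂ (λ U W → Edits a U W _) (sym (take-suc-head X x Xx≡c)) (sym (take-suc-head Y y Yy≡c))
               (edits-++ʳ [ c ] e) ,
    k≤

  extend : ∀ {j x₀ y₀ U W k R S} → Path j x₀ y₀ → Alignment U W k →
           U ++ R ≡ drop x₀ X → W ++ S ≡ drop y₀ Y →
           Path (j + k) (x₀ + length U) (y₀ + length W)
  extend {j} {x₀} {y₀} p ∅ _ _ =
    cast (sym (+-identityʳ j)) (sym (+-identityʳ x₀)) (sym (+-identityʳ y₀)) p
  extend {j} {x₀} p (del∷_ {u = u} {k = k} q) U⊑X W⊑Y =
    cast (xy∙z≈y∙xz a j k) (sym (+-suc x₀ (length u))) refl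
         (extend (delete′ p) q (drop-suc X x₀ U⊑X) W⊑Y)
  extend {j} {y₀ = y₀} p (ins∷_ {w = w} {k = k} q) U⊑X W⊑Y =
    cast (xy∙z≈y∙xz a j k) refl (sym (+-suc y₀ (length w)))
         (extend (insert′ p) q U⊑X (drop-suc Y y₀ W⊑Y))
  extend {x₀ = x₀} {y₀} p (mat∷_ {u = u} {w} q) U⊑X W⊑Y =
    cast refl (sym (+-suc x₀ (length u))) (sym (+-suc y₀ (length w)))
         (extend (match (_ , cong head (sym U⊑X) , cong head (sym W⊑Y)) p) q
                 (drop-suc X x₀ U⊑X) (drop-suc Y y₀ W⊑Y))
  extend {j} {x₀} {y₀} p (sub∷_ {u = u} {w} {k} q) U⊑X W⊑Y =
    cast (sym (+-suc j k)) (sym (+-suc x₀ (length u))) (sym (+-suc y₀ (length w)))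
         (extend (substitute p) q (drop-suc X x₀ U⊑X) (drop-suc Y y₀ W⊑Y))

  alignment⇒path : ∀ {x y k} → Alignment (take x X) (take y Y) k →
                   x ≤ length X → y ≤ length Y → Path k x y
  alignment⇒path {x} {y} q x≤∣X∣ y≤∣Y∣ =
    cast refl (length-take-≤ X x x≤∣X∣) (length-take-≤ Y y y≤∣Y∣)
         (extend origin q (take++drop≡id x X) (take++drop≡id y Y))

  EDa≤⇒path : ∀ {j x y} → EDa≤ a (take x X) (take y Y) j →
              x ≤ length X → y ≤ length Y → Path j x y
  EDa≤⇒path (c , edits , c≤j) x≤∣X∣ y≤∣Y∣ with edits⇒alignment edits
  ... | k , k≤c , alignment = Path-mono (≤-trans k≤c c≤j) (alignment⇒path alignment x≤∣X∣ y≤∣Y∣)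

  retreatʸ : ∀ {k x y} → Path k x (suc y) → Path (a + k) x y
  retreatʸ (delete {k} a≤k p) =
    delete (m≤m+n a k) (cast (trans (m+[n∸m]≡n a≤k) (sym (m+n∸m≡n a k))) refl refl (retreatʸ p))
  retreatʸ (insert {k} a≤k p) = Path-mono (≤-trans (m∸n≤m k a) (m≤n+m k a)) p
  retreatʸ (substitute {k} p) = delete′ (Path-mono (n≤1+n k) p)
  retreatʸ (match m p)        = delete′ p

  retreatˣ : ∀ {k x y} → Path k (suc x) y → Path (a + k) x y
  retreatˣ (delete {k} a≤k p) = Path-mono (≤-trans (m∸n≤m k a) (m≤n+m k a)) p
  retreatˣ (insert {k} a≤k p) =
    insert (m≤m+n a k) (cast (trans (m+[n∸m]≡n a≤k) (sym (m+n∸m≡n a k))) refl refl (retreatˣ p))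
  retreatˣ (substitute {k} p) = insert′ (Path-mono (n≤1+n k) p)
  retreatˣ (match m p)        = insert′ p

  retreat : ∀ {j x y} → Path j (suc x) (suc y) → Path j x y
  retreat (delete a≤j p)     = cast (m+[n∸m]≡n a≤j) refl refl (retreatʸ p)
  retreat (insert a≤j p)     = cast (m+[n∸m]≡n a≤j) refl refl (retreatˣ p)
  retreat (substitute {j} p) = Path-mono (n≤1+n j) p
  retreat (match m p)        = p

  retreat* : ∀ {j x y} k → Path j (x + k) (y + k) → Path j x y
  retreat* {x = x} {y} zero    p = cast refl (+-identityʳ x) (+-identityʳ y) p
  retreat* {x = x} {y} (suc k) p = retreat* k (retreat (cast refl (+-suc x k) (+-suc y k) p))

  insertions : ∀ {j} y → y * a ≤ j → Path j 0 y
  insertions zero    _     = origin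
  insertions (suc y) a+y*a≤j =
    insert (≤-trans (m≤m+n a (y * a)) a+y*a≤j) (insertions y (n+m≤o⇒m≤o∸n a+y*a≤j))

  deletions : ∀ {j} x → x * a ≤ j → Path j x 0
  deletions zero    _     = origin
  deletions (suc x) a+x*a≤j =
    delete (≤-trans (m≤m+n a (x * a)) a+x*a≤j) (deletions x (n+m≤o⇒m≤o∸n a+x*a≤j))

  deletion-bound : ∀ {j x y} → Path j x y → (x ∸ y) * a ≤ j
  deletion-bound origin = z≤n
  deletion-bound {j} {suc x} {y} (delete a≤j p) = begin
    (suc x ∸ y) * a      ≤⟨ *-monoˡ-≤ a (1+m∸n≤1+[m∸n] x y) ⟩
    a + (x ∸ y) * a      ≤⟨ m≤o∸n⇒n+m≤o a≤j (deletion-bound p) ⟩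
    j                    ∎
    where open ≤-Reasoning
  deletion-bound {j} {x} {suc y} (insert a≤j p) = begin
    (x ∸ suc y) * a      ≤⟨ *-monoˡ-≤ a (∸-monoʳ-≤ x (n≤1+n y)) ⟩
    (x ∸ y) * a          ≤⟨ deletion-bound p ⟩
    j ∸ a                ≤⟨ m∸n≤m j a ⟩
    j                    ∎
    where open ≤-Reasoning
  deletion-bound (substitute {j} p) = ≤-trans (deletion-bound p) (n≤1+n j)
  deletion-bound (match m p)        = deletion-bound p

  insertion-bound : ∀ {j x y} → Path j x y → (y ∸ x) * a ≤ j
  insertion-bound origin = z≤n
  insertion-bound {j} {suc x} {y} (delete a≤j p) = begin
    (y ∸ suc x) * a      ≤⟨ *-monoˡ-≤ a (∸-monoʳ-≤ y (n≤1+n x)) ⟩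
    (y ∸ x) * a          ≤⟨ insertion-bound p ⟩
    j ∸ a                ≤⟨ m∸n≤m j a ⟩
    j                    ∎
    where open ≤-Reasoning
  insertion-bound {j} {x} {suc y} (insert a≤j p) = begin
    (suc y ∸ x) * a      ≤⟨ *-monoˡ-≤ a (1+m∸n≤1+[m∸n] y x) ⟩
    a + (y ∸ x) * a      ≤⟨ m≤o∸n⇒n+m≤o a≤j (insertion-bound p) ⟩
    j                    ∎
    where open ≤-Reasoning
  insertion-bound (substitute {j} p) = ≤-trans (insertion-bound p) (n≤1+n j)
  insertion-bound (match m p)        = insertion-bound p

  retreat-diagonal : ∀ {j x y x′ y′} → x ≤ x′ → y′ + x ≡ x′ + y → Path j x′ y′ → Path j x y
  retreat-diagonal {x = x} {y} {x′} {y′} x≤x′ y′+x≡x′+y p =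
    retreat* (x′ ∸ x) (cast refl x′≡x+k y′≡y+k p)
    where
      x′≡x+k : x′ ≡ x + (x′ ∸ x)
      x′≡x+k = sym (m+[n∸m]≡n x≤x′)
      y′≡y+k : y′ ≡ y + (x′ ∸ x)
      y′≡y+k = +-cancelʳ-≡ x y′ (y + (x′ ∸ x))
        (trans y′+x≡x′+y (trans (cong (_+ y) x′≡x+k) (xy∙z≈zy∙x x (x′ ∸ x) y)))

  diagonal-bound : ∀ {j x y} .{{_ : NonZero a}} → Path j x y → ∣ diagonal x y ∣ ≤ j / a
  diagonal-bound {x = x} {y} p =
    ∣diagonal∣≤ x y (m*n≤o⇒m≤o/n (deletion-bound p)) (m*n≤o⇒m≤o/n (insertion-bound p))

-- The table

module TableProperties {A : Set} (_≟_ : DecidableEquality A) (X Y : List A)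
                       (a : ℕ) .{{_ : NonZero a}} where
  open Table _≟_ X Y a
  open Paths X Y a

  -- back, candidates, clamp and start restate the where-clauses of Table.entry:
  -- D_{v-1}, the maximum of the three terms, the minimum with |X| and |Y| - s,
  -- and the correction at s = 0.
  Row : Set
  Row = ℕ → ℤ → ℤ∞

  back : ℕ → Row → ℤ → ℤ∞
  back j P t with a ℕ.≤? j
  ... | yes _ = P (j ∸ a) t
  ... | no  _ = -∞

  candidates : (ℤ → ℤ∞) → ℕ → Row → ℤ → ℤ∞
  candidates B j P s = max∞ (B (s - + 1)) (max∞ (inc∞ (prevRow j P s)) (inc∞ (B (s ℤ.+ + 1))))

  clamp : (ℤ → ℤ∞) → ℕ → Row → ℤ → ℤ∞
  clamp B j P s = min∞ (+ length X) (min∞ (+ length Y - s) (candidates B j P s))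

  start : ℕ → Row → ℤ → ℤ∞
  start j P s with s ℤ.≟ + 0
  ... | yes _ = max∞ (clamp (back j P) j P s) (fin (+ 0))
  ... | no  _ = clamp (back j P) j P s

  extendLCE : ℤ → ℤ → ℤ
  extendLCE d s = d ℤ.+ + LCE _≟_ X Y d (d ℤ.+ s)

  extendLCE∞ : ℤ → ℤ∞ → ℤ∞
  extendLCE∞ s -∞      = -∞
  extendLCE∞ s (fin d) = fin (extendLCE d s)

  entry-unbounded : ∀ j P s → ¬ ∣ s ∣ ℕ.≤ j / a → entry j P s ≡ -∞
  entry-unbounded j P s unbounded with ∣ s ∣ ℕ.≤? j / a
  ... | yes bounded = ⊥-elim (unbounded bounded)
  ... | no  _       = refl

  entry-unfold : ∀ j P s → ∣ s ∣ ℕ.≤ j / a → entry j P s ≡ extendLCE∞ s (start j P s)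
  -- The splits retrace those of entry; only then do both sides reduce to the same
  -- argument of the final LCE step, on which we split once more.
  entry-unfold j P s bounded with ∣ s ∣ ℕ.≤? j / a
  ... | no unbounded = ⊥-elim (unbounded bounded)
  ... | yes _ with s ℤ.≟ + 0
  ... | yes _ with a ℕ.≤? j
  ...   | yes _ with max∞ (clamp (P (j ∸ a)) j P s) (fin (+ 0))
  ...     | -∞    = refl
  ...     | fin _ = refl
  entry-unfold j P s _ | yes _ | yes _ | no _ with max∞ (clamp (λ _ → -∞) j P s) (fin (+ 0))
  ...     | -∞    = refl
  ...     | fin _ = refl
  entry-unfold j P s _ | yes _ | no _ with a ℕ.≤? j
  ...   | yes _ with clamp (P (j ∸ a)) j P s
  ...     | -∞    = refl
  ...     | fin _ = refl
  entry-unfold j P s _ | yes _ | no _ | no _ with clamp (λ _ → -∞) j P s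
  ...     | -∞    = refl
  ...     | fin _ = refl

  data Reason (j : ℕ) (P : Row) (s v : ℤ) : Set where
    from-origin        : s ≡ + 0 → v ℤ.≤ + 0 → Reason j P s v
    after-insertion    : v ≤∞ back j P (s - + 1) → Reason j P s v
    after-substitution : v ≤∞ inc∞ (prevRow j P s) → Reason j P s v
    after-deletion     : v ≤∞ inc∞ (back j P (s ℤ.+ + 1)) → Reason j P s v

  Candidate : ℕ → Row → ℤ → ℤ → Set
  Candidate j P s v = v ℤ.≤ + length X × v ℤ.≤ + length Y - s × Reason j P s v

  candidates-intro : ∀ {j P s v} → Reason j P s v →
                     (s ≡ + 0 × v ℤ.≤ + 0) ⊎ v ≤∞ candidates (back j P) j P s
  candidates-intro (from-origin s≡0 v≤0) = inj₁ (s≡0 , v≤0)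
  candidates-intro {j} {P} {s} (after-insertion h) =
    inj₂ (≤∞-max∞ˡ (back j P (s - + 1)) _ h)
  candidates-intro {j} {P} {s} (after-substitution h) =
    inj₂ (≤∞-max∞ʳ (back j P (s - + 1)) _ (≤∞-max∞ˡ (inc∞ (prevRow j P s)) _ h))
  candidates-intro {j} {P} {s} (after-deletion h) =
    inj₂ (≤∞-max∞ʳ (back j P (s - + 1)) _ (≤∞-max∞ʳ (inc∞ (prevRow j P s)) _ h))

  candidates-elim : ∀ {j P s v} → v ≤∞ candidates (back j P) j P s → Reason j P s v
  candidates-elim {j} {P} {s} h with ≤∞-max∞⁻ (back j P (s - + 1)) _ h
  ... | inj₁ h₁ = after-insertion h₁
  ... | inj₂ h₂ with ≤∞-max∞⁻ (inc∞ (prevRow j P s)) _ h₂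
  ...   | inj₁ h₂₁ = after-substitution h₂₁
  ...   | inj₂ h₂₂ = after-deletion h₂₂

  clamp-elim : ∀ {j P s v} → v ≤∞ clamp (back j P) j P s → Candidate j P s v
  clamp-elim h with ≤∞-min∞⁻ _ _ h
  ... | v≤X , h′ with ≤∞-min∞⁻ _ _ h′
  ...   | v≤Y-s , h″ = v≤X , v≤Y-s , candidates-elim h″

  start-intro : ∀ {j P s v} → Candidate j P s v → v ≤∞ start j P s
  start-intro {j} {P} {s} (v≤X , v≤Y-s , r) with s ℤ.≟ + 0 | candidates-intro r
  ... | yes _   | inj₁ (_ , v≤0)  = ≤∞-max∞ʳ (clamp (back j P) j P s) _ (fin≤ v≤0)
  ... | yes _   | inj₂ h          = ≤∞-max∞ˡ _ (fin (+ 0)) (≤∞-min∞ _ _ v≤X (≤∞-min∞ _ _ v≤Y-s h))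
  ... | no s≢0  | inj₁ (s≡0 , _)  = ⊥-elim (s≢0 s≡0)
  ... | no _    | inj₂ h          = ≤∞-min∞ _ _ v≤X (≤∞-min∞ _ _ v≤Y-s h)

  start-elim : ∀ {j P s v} → v ≤∞ start j P s → Candidate j P s v
  start-elim {j} {P} {s} h with s ℤ.≟ + 0
  ... | no _ = clamp-elim h
  ... | yes refl with ≤∞-max∞⁻ (clamp (back j P) j P s) _ h
  ...   | inj₁ h′         = clamp-elim h′
  ...   | inj₂ (fin≤ v≤0) = ℤ.≤-trans v≤0 (ℤ.+≤+ z≤n) , ℤ.≤-trans v≤0 (ℤ.+≤+ z≤n) , from-origin refl v≤0

  D-unfold : ∀ j s → D j s ≡ entry j (tab j) s
  D-unfold j s with j ℕ.<? j | j ℕ.≟ j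
  ... | yes j<j | _      = ⊥-elim (<-irrefl refl j<j)
  ... | no _    | yes _  = refl
  ... | no _    | no j≢j = ⊥-elim (j≢j refl)

  tab-lookup : ∀ n i s → i < n → tab n i s ≡ D i s
  tab-lookup (suc n) i s i<1+n with i ℕ.<? n | i ℕ.≟ n
  ... | yes i<n | _        = tab-lookup n i s i<n
  ... | no _    | yes refl = sym (D-unfold i s)
  ... | no i≮n  | no i≢n   = ⊥-elim (i≢n (≤-antisym (≤-pred i<1+n) (≮⇒≥ i≮n)))

  j∸a<j : ∀ {j} → a ≤ j → j ∸ a < j
  j∸a<j = ∸-monoʳ-< (ℕ.>-nonZero⁻¹ a)

  back-intro : ∀ {v} j t → a ≤ j → v ≤∞ D (j ∸ a) t → v ≤∞ back j (tab j) t
  back-intro j t a≤j h with a ℕ.≤? j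
  ... | yes _   = subst (_ ≤∞_) (sym (tab-lookup j (j ∸ a) t (j∸a<j a≤j))) h
  ... | no a≰j  = ⊥-elim (a≰j a≤j)

  back-elim : ∀ {v} j t → v ≤∞ back j (tab j) t → a ≤ j × v ≤∞ D (j ∸ a) t
  back-elim j t h with a ℕ.≤? j
  ... | yes a≤j = a≤j , subst (_ ≤∞_) (tab-lookup j (j ∸ a) t (j∸a<j a≤j)) h

  prevRow-elim : ∀ {v} j s → ℤ.suc v ≤∞ inc∞ (prevRow j (tab j) s) → ∃ λ j′ → j ≡ suc j′ × v ≤∞ D j′ s
  prevRow-elim (suc j′) s h = j′ , refl , ≤∞-inc∞⁻ (D j′ s) h

  ≤∞-extendLCE∞ : ∀ {v} s p → v ≤∞ p → v ≤∞ extendLCE∞ s p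
  ≤∞-extendLCE∞ s (fin d) (fin≤ v≤d) = fin≤ (ℤ.≤-trans v≤d (ℤ.i≤i+j d (+ LCE _≟_ X Y d (d ℤ.+ s))))

  D-intro : ∀ {j s v} → ∣ s ∣ ℕ.≤ j / a → Candidate j (tab j) s v → v ≤∞ D j s
  D-intro {j} {s} bounded c = subst (_ ≤∞_)
    (sym (trans (D-unfold j s) (entry-unfold j (tab j) s bounded)))
    (≤∞-extendLCE∞ s (start j (tab j) s) (start-intro c))

  record Entry (j : ℕ) (s v : ℤ) : Set where
    field
      bounded   : ∣ s ∣ ℕ.≤ j / a
      d         : ℤ
      value     : D j s ≡ fin (extendLCE d s)
      below     : v ℤ.≤ extendLCE d s
      candidate : Candidate j (tab j) s d

  D-elim : ∀ {j s v} → v ≤∞ D j s → Entry j s v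
  D-elim {j} {s} {v} v≤D = decide (∣ s ∣ ℕ.≤? j / a)
    where
      v≤entry : v ≤∞ entry j (tab j) s
      v≤entry = subst (v ≤∞_) (D-unfold j s) v≤D

      settle : ∣ s ∣ ℕ.≤ j / a → ∀ e → start j (tab j) s ≡ e → v ≤∞ extendLCE∞ s e → Entry j s v
      settle bounded (fin d) start≡d (fin≤ below) = record
        { bounded   = bounded
        ; d         = d
        ; value     = trans (trans (D-unfold j s) (entry-unfold j (tab j) s bounded))
                            (cong (extendLCE∞ s) start≡d)
        ; below     = below
        ; candidate = start-elim (subst (d ≤∞_) (sym start≡d) (fin≤ ℤ.≤-refl))
        }

      decide : Dec (∣ s ∣ ℕ.≤ j / a) → Entry j s v
      decide (yes bounded) =
        settle bounded (start j (tab j) s) refl (subst (v ≤∞_) (entry-unfold j (tab j) s bounded) v≤entry)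
      decide (no unbounded) with subst (v ≤∞_) (entry-unbounded j (tab j) s unbounded) v≤entry
      ... | ()

  slide : ∀ {j p q} ℓ → ℓ ≤ lcp _≟_ (drop p X) (drop q Y) → Path j p q → Path j (p + ℓ) (q + ℓ)
  slide {p = p} {q} zero    _     path = cast refl (sym (+-identityʳ p)) (sym (+-identityʳ q)) path
  slide {p = p} {q} (suc ℓ) ℓ<lcp path with lcp-head _≟_ (drop p X) (drop q Y) ℓ ℓ<lcp
  ... | c , Xc , Yc =
    cast refl (sym (+-suc p ℓ)) (sym (+-suc q ℓ))
         (match (c , trans (cong head (drop-+ X p ℓ)) Xc , trans (cong head (drop-+ Y q ℓ)) Yc)
                (slide ℓ (<⇒≤ ℓ<lcp) path))

  -- The LCE run from the grid point (p, q) = (d, d + s) reaches x on the diagonal s.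
  record Anchor (d : ℤ) (x y : ℕ) : Set where
    field
      p q         : ℕ
      d≡p         : d ≡ + p
      on-diagonal : + p ℤ.+ diagonal x y ≡ + q
      x≤p+ℓ       : x ≤ p + lcp _≟_ (drop p X) (drop q Y)

  anchor : ∀ d x y → + x ℤ.≤ extendLCE d (diagonal x y) → Anchor d x y
  anchor (+ p) x y x≤ with + p ℤ.+ diagonal x y in eq
  ... | -[1+ _ ] = ⊥-elim (p+diagonal≢-[1+m] p x y (subst (x ≤_) (+-identityʳ p) (ℤ.drop‿+≤+ x≤)) eq)
  ... | + q      = record { p = p ; q = q ; d≡p = refl ; on-diagonal = eq ; x≤p+ℓ = ℤ.drop‿+≤+ x≤ }

  extendLCE-match : ∀ d x y → + x ℤ.≤ extendLCE d (diagonal x y) → Match x y →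
                    + suc x ℤ.≤ extendLCE d (diagonal x y)
  extendLCE-match d x y x≤ (c , Xc , Yc) with anchor d x y x≤
  ... | record { p = p ; q = q ; d≡p = refl ; on-diagonal = eq ; x≤p+ℓ = x≤p+ℓ } rewrite eq =
    ℤ.+≤+ (≤∧≢⇒< x≤p+ℓ x≢p+ℓ)
    where
      ℓ : ℕ
      ℓ = lcp _≟_ (drop p X) (drop q Y)

      x≢p+ℓ : x ≢ p + ℓ
      x≢p+ℓ refl = lcp-maximal _≟_ (drop p X) (drop q Y)
        (trans (sym (cong head (drop-+ X p ℓ))) Xc)
        (trans (sym (cong head (drop-+ Y q ℓ))) (subst (λ y′ → head (drop y′ Y) ≡ just c) y≡q+ℓ Yc))
        where
          y≡q+ℓ : y ≡ q + ℓ
          y≡q+ℓ = +-cancelˡ-≡ p y (q + ℓ) (trans (sym (p+diagonal≡q p q x y eq)) (x∙yz≈y∙xz q p ℓ))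

  reached : ∀ {j x y} → Path j x y → x ≤ length X → y ≤ length Y →
            Reason j (tab j) (diagonal x y) (+ x) → + x ≤∞ D j (diagonal x y)
  reached {x = x} {y} p x≤X y≤Y r =
    D-intro (diagonal-bound p) (ℤ.+≤+ x≤X , x≤L-diagonal (length Y) x y y≤Y , r)

  complete : ∀ {j x y} → Path j x y → x ≤ length X → y ≤ length Y → + x ≤∞ D j (diagonal x y)
  complete p@origin x≤X y≤Y = reached p x≤X y≤Y (from-origin refl ℤ.≤-refl)
  complete {j} {suc x} {y} p@(delete a≤j p′) x≤X y≤Y =
    reached p x≤X y≤Y (after-deletion (≤∞-inc∞ _ (back-intro j _ a≤j
      (subst (λ t → + x ≤∞ D (j ∸ a) t) (sym (diagonal-sucˣ x y)) (complete p′ (<⇒≤ x≤X) y≤Y)))))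
  complete {j} {x} {suc y} p@(insert a≤j p′) x≤X y≤Y =
    reached p x≤X y≤Y (after-insertion (back-intro j _ a≤j
      (subst (λ t → + x ≤∞ D (j ∸ a) t) (sym (diagonal-sucʸ x y)) (complete p′ x≤X (<⇒≤ y≤Y)))))
  complete {suc j} {suc x} {suc y} p@(substitute p′) x≤X y≤Y =
    reached p x≤X y≤Y (after-substitution (≤∞-inc∞ (D j _)
      (subst (λ t → + x ≤∞ D j t) (sym (diagonal-suc x y)) (complete p′ (<⇒≤ x≤X) (<⇒≤ y≤Y)))))
  complete {j} {suc x} {suc y} (match m p′) x≤X y≤Y rewrite diagonal-suc x y =
    subst (+ suc x ≤∞_) (sym value) (fin≤ (extendLCE-match d x y below m))
    where open Entry (D-elim {j} {diagonal x y} (complete p′ (<⇒≤ x≤X) (<⇒≤ y≤Y)))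


  Sound : ℕ → Set
  Sound j = ∀ {x y} → x ≤ length X → y ≤ length Y → + x ≤∞ D j (diagonal x y) → Path j x y

  reason⇒path : ∀ {j s d x y} → WfRec _<_ Sound j → ∣ s ∣ ℕ.≤ j / a → Reason j (tab j) s d →
                diagonal x y ≡ s → x ≤ length X → y ≤ length Y → + x ℤ.≤ d → Path j x y
  reason⇒path {j} {x = zero} {y} _ bounded _ e _ _ _ =
    insertions y (m≤o/n⇒m*n≤o (subst (_≤ j / a) (trans (cong ∣_∣ (sym e)) (∣diagonal-0y∣ y)) bounded))
  reason⇒path {j} {x = suc x} {zero} _ bounded _ e _ _ _ =
    deletions (suc x)
      (m≤o/n⇒m*n≤o (subst (_≤ j / a) (trans (cong ∣_∣ (sym e)) (∣diagonal-x0∣ (suc x))) bounded))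
  reason⇒path {x = suc x} {suc y} _ _ (from-origin _ d≤0) _ _ _ x<d
    with ℤ.drop‿+≤+ (ℤ.≤-trans x<d d≤0)
  ... | ()
  reason⇒path {j} {x = suc x} {suc y} sound< _ (after-insertion h) e x<X y<Y x<d
    with back-elim j _ (≤∞-trans x<d h)
  ... | a≤j , h′ = insert a≤j (sound< (j∸a<j a≤j) x<X (<⇒≤ y<Y)
    (subst (λ t → + suc x ≤∞ D (j ∸ a) t) (trans (cong (_- + 1) (sym e)) (diagonal-sucʸ (suc x) y)) h′))
  reason⇒path {j} {s} {x = suc x} {suc y} sound< _ (after-substitution h) e x<X y<Y x<d
    with prevRow-elim {+ x} j s (≤∞-trans x<d h)
  ... | j′ , refl , h′ = substitute (sound< ≤-refl (<⇒≤ x<X) (<⇒≤ y<Y)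
    (subst (λ t → + x ≤∞ D j′ t) (trans (sym e) (diagonal-suc x y)) h′))
  reason⇒path {j} {s} {x = suc x} {suc y} sound< _ (after-deletion h) e x<X y<Y x<d
    with back-elim j _ (≤∞-inc∞⁻ (back j (tab j) (s ℤ.+ + 1)) (≤∞-trans x<d h))
  ... | a≤j , h′ = delete a≤j (sound< (j∸a<j a≤j) (<⇒≤ x<X) y<Y
    (subst (λ t → + x ≤∞ D (j ∸ a) t) (trans (cong (ℤ._+ + 1) (sym e)) (diagonal-sucˣ x (suc y))) h′))

  sound-step : ∀ j → WfRec _<_ Sound j → Sound j
  sound-step j sound< {x} {y} x≤X y≤Y x≤D =
    retreat-diagonal x≤p+ℓ same-diagonal
      (slide ℓ ≤-refl (reason⇒path sound< bounded reason (diagonal≡ p q s on-diagonal) p≤X q≤Y p≤d))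
    where
      s : ℤ
      s = diagonal x y

      open Entry (D-elim {j} {s} x≤D)
      open Anchor (anchor d x y below)

      ℓ : ℕ
      ℓ = lcp _≟_ (drop p X) (drop q Y)

      reason : Reason j (tab j) s d
      reason = proj₂ (proj₂ candidate)

      p≤d : + p ℤ.≤ d
      p≤d = ℤ.≤-reflexive (sym d≡p)

      p≤X : p ≤ length X
      p≤X = ℤ.drop‿+≤+ (subst (ℤ._≤ + length X) d≡p (proj₁ candidate))

      q≤Y : q ≤ length Y
      q≤Y = q≤L p q (length Y) s on-diagonal (subst (ℤ._≤ _) d≡p (proj₁ (proj₂ candidate)))

      same-diagonal : (q + ℓ) + x ≡ (p + ℓ) + y
      same-diagonal = trans (xy∙z≈xz∙y q ℓ x)
        (trans (cong (_+ ℓ) (p+diagonal≡q p q x y on-diagonal)) (xy∙z≈xz∙y p y ℓ))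

  sound : ∀ j → Sound j
  sound = <-rec Sound sound-step

lemma10 : {A : Set} (_≟_ : DecidableEquality A) (X Y : List A)
    (a : ℕ) .{{_ : NonZero a}} (K : ℕ) (j : ℕ) → j ≤ K →
    (x y : ℕ) → x ≤ length X → y ≤ length Y →
    EDa≤ a (take x X) (take y Y) j
    ⇔ (+ x ≤∞ Table.D _≟_ X Y a j (+ y - + x))
lemma10 _≟_ X Y a _ j _ x y x≤X y≤Y =
  mk⇔ (λ ED≤j → complete (EDa≤⇒path ED≤j x≤X y≤Y) x≤X y≤Y)
      (λ x≤D → path⇒EDa≤ (sound j x≤X y≤Y x≤D) x≤X y≤Y)
  where
    open Paths X Y a
    open TableProperties _≟_ X Y a
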